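{- Let $k\ge 0$ be an integer and let $M$ be the program (sentence) described below, with intensional predicates $\mathbf p=(\mathit{step},\mathit{next},\mathit{at})$. Then $\mathrm{SM}_{\mathbf p}[M]$ is logically equivalent to the conjunction of $H$ with the universal closures of the formulas $$\mathit{step}(z)\leftrightarrow\bigvee_{i=0}^{k}z=\widehat i,\qquad \mathit{next}(z,u)\leftrightarrow\bigvee_{i=0}^{k-1}(z=\widehat i\land u=\widehat{i+1}),$$ $$\mathit{at}(x,y,\widehat{i+1})\leftrightarrow\big(\mathit{move}(x,y,\widehat i)\lor(\mathit{at}(x,y,\widehat i)\land\neg\exists w\,\mathit{move}(x,w,\widehat i))\big)\qquad(i=0,\dots,k-1).$$
   Context: Formulas are first-order formulas with equality built using $\bot,\land,\lor,\rightarrow,\forall,\exists$; $\neg F$ is $F\rightarrow\bot$, $F\leftrightarrow G$ is $(F\rightarrow G)\land(G\rightarrow F)$, $\widetilde\forall$ is universal closure; equivalence is with respect to arbitrary first-order interpretations. A rule $p(\mathbf t)\leftarrow G$ stands for $\widetilde\forall(G\rightarrow p(\mathbf t))$; a choice rule $\{p(\mathbf t)\}\leftarrow G$ stands for $\widetilde\forall(G\rightarrow p(\mathbf t)\lor\neg p(\mathbf t))$; a constraint $\leftarrow G$ stands for $\widetilde\forall\neg G$; a program is the conjunction of its members. Signature: object constants $\widehat 0,\dots,\widehat k$; unary predicate constants $\mathit{object},\mathit{place},\mathit{step}$; binary $\mathit{next}$; ternary $\mathit{at},\mathit{move}$. The program $M$ consists of: (i) the facts $\mathit{step}(\widehat 0),\dots,\mathit{step}(\widehat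 k)$ and $\mathit{next}(\widehat 0,\widehat 1),\dots,\mathit{next}(\widehat{k-1},\widehat k)$; (ii) the constraints $\leftarrow\widehat i=\widehat j$ for $0\le i<j\le k$; (iii) $\leftarrow\mathit{at}(x,y,z)\land\neg(\mathit{object}(x)\land\mathit{place}(y)\land\mathit{step}(z))$ and $\leftarrow\mathit{move}(x,y,z)\land\neg(\mathit{object}(x)\land\mathit{place}(y)\land\mathit{step}(z))$; (iv) $\leftarrow\mathit{at}(x,y_1,z)\land\mathit{at}(x,y_2,z)\land y_1\ne y_2$; (v) $\leftarrow\mathit{object}(x)\land\mathit{step}(z)\land\neg\exists y\,\mathit{at}(x,y,z)$; (vi) $\mathit{at}(x,y,u)\leftarrow\mathit{move}(x,y,z)\land\mathit{next}(z,u)$; (vii) $\{\mathit{at}(x,y,\widehat 0)\}\leftarrow\mathit{object}(x)\land\mathit{place}(y)$; (viii) $\{\mathit{at}(x,y,u)\}\leftarrow\mathit{at}(x,y,z)\land\mathit{next}(z,u)$. $H$ is the conjunction of the universal closures of: $\widehat i\ne\widehat j$ ($0\le i<j\le k$); $\mathit{at}(x,y,z)\rightarrow\mathit{object}(x)\land\mathit{place}(y)\land\mathit{step}(z)$; $\mathit{move}(x,y,z)\rightarrow\mathit{object}(x)\land\mathit{place}(y)\land\mathit{step}(z)$; $\mathit{at}(x,y_1,z)\land\mathit{at}(x,y_2,z)\rightarrow y_1=y_2$; $\mathit{object}(x)\land\mathit{step}(z)\rightarrow\exists y\,\mathit{at}(x,y,z)$. Operator SM: for a sentence $F$ and a tuple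 $\mathbf p=p_1,\dots,p_n$ of distinct predicate constants (not equality), let $\mathbf u=u_1,\dots,u_n$ be predicate variables of the same arities. Define $F^*(\mathbf u)$: $p_i(\mathbf t)^*=u_i(\mathbf t)$; $A^*=A$ for other atomic $A$ (including equalities and atoms of predicates not in $\mathbf p$); $\bot^*=\bot$; $(F\land G)^*=F^*\land G^*$; $(F\lor G)^*=F^*\lor G^*$; $(F\rightarrow G)^*=(F^*\rightarrow G^*)\land(F\rightarrow G)$; $(\forall xF)^*=\forall xF^*$; $(\exists xF)^*=\exists xF^*$. With $\mathbf u\le\mathbf p$ meaning $\bigwedge_i\forall\mathbf x(u_i(\mathbf x)\rightarrow p_i(\mathbf x))$ and $\mathbf u<\mathbf p$ meaning $(\mathbf u\le\mathbf p)\land\neg(\mathbf p\le\mathbf u)$, $\mathrm{SM}_{\mathbf p}[F]=F\land\neg\exists\mathbf u((\mathbf u<\mathbf p)\land F^*(\mathbf u))$. -}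

module Defs where

open import Data.Nat using (ℕ; zero; suc; _<ᵇ_)
open import Data.Fin using (Fin; zero; suc; inject₁; toℕ)
open import Data.Vec using (Vec; []; _∷_)
import Data.Vec as V
open import Data.List using (List; []; _∷_; concatMap; allFin)
import Data.List as L
open import Data.Bool using (if_then_else_)
open import Data.Product using (Σ; _×_)
open import Data.Sum using (_⊎_)
open import Data.Empty using (⊥)
open import Relation.Binary.PropositionalEquality using (_≡_)
open import Relation.Nullary using (¬_)

data IPred : ℕ → Set where
  step : IPred 1
  next : IPred 2
  at   : IPred 3

data Pred : ℕ → Set where
  intl   : ∀ {a} → IPred a → Pred a
  object : Pred 1
  place  : Pred 1
  move   : Pred 3

data Term (k n : ℕ) : Set where
  var : Fin n → Term k n
  con : Fin (suc k) → Term k n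

infixr 6 _∧'_
infixr 5 _∨'_
infixr 4 _⇒'_
infix 7 _≐_

data Formula (k : ℕ) : ℕ → Set where
  ⊥'    : ∀ {n} → Formula k n
  atom  : ∀ {n a} → Pred a → Vec (Term k n) a → Formula k n
  _≐_   : ∀ {n} → Term k n → Term k n → Formula k n
  _∧'_  : ∀ {n} → Formula k n → Formula k n → Formula k n
  _∨'_  : ∀ {n} → Formula k n → Formula k n → Formula k n
  _⇒'_  : ∀ {n} → Formula k n → Formula k n → Formula k n
  ∀'    : ∀ {n} → Formula k (suc n) → Formula k n
  ∃'    : ∀ {n} → Formula k (suc n) → Formula k n

module _ {k : ℕ} where

  ¬' : ∀ {n} → Formula k n → Formula k n
  ¬' F = F ⇒' ⊥'

  infixr 4 _⇔'_
  _⇔'_ : ∀ {n} → Formula k n → Formula k n → Formula k n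
  F ⇔' G = (F ⇒' G) ∧' (G ⇒' F)

  ⊤' : ∀ {n} → Formula k n
  ⊤' = ¬' ⊥'

  ⋀ : ∀ {n} → List (Formula k n) → Formula k n
  ⋀ []       = ⊤'
  ⋀ (F ∷ Fs) = F ∧' ⋀ Fs

  ⋁ : ∀ {n} → List (Formula k n) → Formula k n
  ⋁ []       = ⊥'
  ⋁ (F ∷ Fs) = F ∨' ⋁ Fs

  ∀̃ : ∀ {n} → Formula k n → Formula k 0
  ∀̃ {zero}  F = F
  ∀̃ {suc n} F = ∀̃ (∀' F)

  _⟵_ : ∀ {n} → Formula k n → Formula k n → Formula k 0
  A ⟵ G = ∀̃ (G ⇒' A)

  choice : ∀ {n} → Formula k n → Formula k n → Formula k 0
  choice A G = ∀̃ (G ⇒' (A ∨' ¬' A))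

  constraint : ∀ {n} → Formula k n → Formula k 0
  constraint G = ∀̃ (¬' G)

  Step Object Place : ∀ {n} → Term k n → Formula k n
  Step t   = atom (intl step) (t ∷ [])
  Object t = atom object (t ∷ [])
  Place t  = atom place (t ∷ [])

  Next : ∀ {n} → Term k n → Term k n → Formula k n
  Next t s = atom (intl next) (t ∷ s ∷ [])

  At Move : ∀ {n} → Term k n → Term k n → Term k n → Formula k n
  At t s r   = atom (intl at) (t ∷ s ∷ r ∷ [])
  Move t s r = atom move (t ∷ s ∷ r ∷ [])

  x0 : ∀ {n} → Term k (suc n)
  x0 = var zero
  x1 : ∀ {n} → Term k (suc (suc n))
  x1 = var (suc zero)
  x2 : ∀ {n} → Term k (suc (suc (suc n)))
  x2 = var (suc (suc zero))
  x3 : ∀ {n} → Term k (suc (suc (suc (suc n))))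
  x3 = var (suc (suc (suc zero)))

  ĉ : ∀ {n} → Fin (suc k) → Term k n
  ĉ = con

  distinctPairs : List (Fin (suc k) × Fin (suc k))
  distinctPairs =
    concatMap (λ i → concatMap (λ j → if toℕ i <ᵇ toℕ j then (i Data.Product., j) ∷ [] else [])
                                 (allFin (suc k)))
              (allFin (suc k))

  distinctConsts : List (Formula k 0)
  distinctConsts = L.map (λ p → ¬' (ĉ (Data.Product.proj₁ p) ≐ ĉ (Data.Product.proj₂ p))) distinctPairs

M : (k : ℕ) → Formula k 0
M k = ⋀ (
     L.map (λ i → Step (ĉ i)) (allFin (suc k))
  L.++ L.map (λ i → Next (ĉ (inject₁ i)) (ĉ (suc i))) (allFin k)
  L.++ L.map (λ p → constraint {n = 0} (ĉ (Data.Product.proj₁ p) ≐ ĉ (Data.Product.proj₂ p))) distinctPairs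
  L.++ (
     -- (iii)  variables x,y,z = x0,x1,x2
     constraint {n = 3} (At x0 x1 x2 ∧' ¬' (Object x0 ∧' Place x1 ∧' Step x2))
   ∷ constraint {n = 3} (Move x0 x1 x2 ∧' ¬' (Object x0 ∧' Place x1 ∧' Step x2))
     -- (iv)   x,y1,y2,z = x0,x1,x2,x3
   ∷ constraint {n = 4} (At x0 x1 x3 ∧' At x0 x2 x3 ∧' ¬' (x1 ≐ x2))
     -- (v)    x,z = x0,x1 ; inside ∃y : y,x,z = x0,x1,x2
   ∷ constraint {n = 2} (Object x0 ∧' Step x1 ∧' ¬' (∃' (At x1 x0 x2)))
     -- (vi)   x,y,z,u = x0,x1,x2,x3
   ∷ (_⟵_ {n = 4} (At x0 x1 x3) (Move x0 x1 x2 ∧' Next x2 x3))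
     -- (vii)  x,y = x0,x1
   ∷ choice {n = 2} (At x0 x1 (ĉ zero)) (Object x0 ∧' Place x1)
     -- (viii) x,y,z,u = x0,x1,x2,x3
   ∷ choice {n = 4} (At x0 x1 x3) (At x0 x1 x2 ∧' Next x2 x3)
   ∷ []))

H : (k : ℕ) → Formula k 0
H k = ⋀ (
     distinctConsts
  L.++ (
     ∀̃ {n = 3} (At x0 x1 x2 ⇒' Object x0 ∧' Place x1 ∧' Step x2)
   ∷ ∀̃ {n = 3} (Move x0 x1 x2 ⇒' Object x0 ∧' Place x1 ∧' Step x2)
   ∷ ∀̃ {n = 4} (At x0 x1 x3 ∧' At x0 x2 x3 ⇒' x1 ≐ x2)
   ∷ ∀̃ {n = 2} (Object x0 ∧' Step x1 ⇒' ∃' (At x1 x0 x2))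
   ∷ []))

RHS : (k : ℕ) → Formula k 0
RHS k = H k ∧' (
     ∀̃ {n = 1} (Step x0 ⇔' ⋁ (L.map (λ i → x0 ≐ ĉ i) (allFin (suc k))))
  ∧' ∀̃ {n = 2} (Next x0 x1 ⇔'
        ⋁ (L.map (λ i → x0 ≐ ĉ (inject₁ i) ∧' x1 ≐ ĉ (suc i)) (allFin k)))
     -- for i = 0..k-1 :  x,y = x0,x1 ; inside ∃w : w,x,y = x0,x1,x2
  ∧' ⋀ (L.map (λ i → ∀̃ {n = 2}
        (At x0 x1 (ĉ (suc i)) ⇔'
          (Move x0 x1 (ĉ (inject₁ i)) ∨'
           (At x0 x1 (ĉ (inject₁ i)) ∧' ¬' (∃' (Move x1 x0 (ĉ (inject₁ i))))))))
        (allFin k)))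

record Interp (k : ℕ) : Set₁ where
  field
    D       : Set
    element : D
    const   : Fin (suc k) → D
    rel     : ∀ {a} → Pred a → Vec D a → Set

module _ {k : ℕ} (I : Interp k) where
  open Interp I

  Rel : Set₁
  Rel = ∀ {a} → Pred a → Vec D a → Set

  IRel : Set₁
  IRel = ∀ {a} → IPred a → Vec D a → Set

  extend : ∀ {n} → (Fin n → D) → D → Fin (suc n) → D
  extend ρ d zero    = d
  extend ρ d (suc i) = ρ i

  termVal : ∀ {n} → (Fin n → D) → Term k n → D
  termVal ρ (var i) = ρ i
  termVal ρ (con c) = const c

  eval : Rel → ∀ {n} → Formula k n → (Fin n → D) → Set
  eval R ⊥'         ρ = ⊥
  eval R (atom P ts) ρ = R P (V.map (termVal ρ) ts)
  eval R (t ≐ s)    ρ = termVal ρ t ≡ termVal ρ s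
  eval R (F ∧' G)   ρ = eval R F ρ × eval R G ρ
  eval R (F ∨' G)   ρ = eval R F ρ ⊎ eval R G ρ
  eval R (F ⇒' G)   ρ = eval R F ρ → eval R G ρ
  eval R (∀' F)     ρ = (d : D) → eval R F (extend ρ d)
  eval R (∃' F)     ρ = Σ D (λ d → eval R F (extend ρ d))

  ⟦_⟧ : Formula k 0 → Set
  ⟦ F ⟧ = eval rel F (λ ())

  pI : IRel
  pI P = rel (intl P)

  subst-u : IRel → Rel
  subst-u u (intl P) = u P
  subst-u u object   = rel object
  subst-u u place    = rel place
  subst-u u move     = rel move

  evalStar : IRel → ∀ {n} → Formula k n → (Fin n → D) → Set
  evalStar u ⊥'          ρ = ⊥
  evalStar u (atom P ts) ρ = subst-u u P (V.map (termVal ρ) ts)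
  evalStar u (t ≐ s)     ρ = termVal ρ t ≡ termVal ρ s
  evalStar u (F ∧' G)    ρ = evalStar u F ρ × evalStar u G ρ
  evalStar u (F ∨' G)    ρ = evalStar u F ρ ⊎ evalStar u G ρ
  evalStar u (F ⇒' G)    ρ = (evalStar u F ρ → evalStar u G ρ) × (eval rel F ρ → eval rel G ρ)
  evalStar u (∀' F)      ρ = (d : D) → evalStar u F (extend ρ d)
  evalStar u (∃' F)      ρ = Σ D (λ d → evalStar u F (extend ρ d))

  _≤ᵤ_ : IRel → IRel → Set
  u ≤ᵤ v = ∀ {a} (P : IPred a) (xs : Vec D a) → u P xs → v P xs

  _<ᵤ_ : IRel → IRel → Set
  u <ᵤ v = (u ≤ᵤ v) × ¬ (v ≤ᵤ u)

  SM : Formula k 0 → Set₁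
  SM F = ⟦ F ⟧ × ¬ Σ IRel (λ u → (u <ᵤ pI) × evalStar u F (λ ()))

-- Write p for the intensional part of I.  When I ⊨ M, an interpretation u ≤ p satisfies M⋆(u)
-- exactly when it is a model of the reduct of M relative to p, so SM[M] says that no proper
-- part of p models the reduct.  Deleting one atom from p leaves a model of the reduct unless
-- the atom is a fact or is produced by the move rule, the initial choice or the inertia
-- choice.  Hence in a stable model every step is a constant, next relates exactly consecutive
-- constants, and x is at y at step i+1 only by moving there or by staying at y without moving
-- (functionality of at rules out a move elsewhere).  Conversely, under these completions every
-- model of the reduct contains p, by induction on the step.

module Submission where

open import Defs
open import Data.Nat using (ℕ; zero; suc; _<ᵇ_)
open import Data.Nat.Properties using (<⇒<ᵇ)
open import Data.Bool using (true; T; if_then_else_)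
open import Data.Fin using (Fin; zero; suc; inject₁; toℕ; _<_)
open import Data.Fin.Induction using (<-weakInduction)
open import Data.Fin.Properties using (<-cmp; suc-injective)
open import Data.Vec using (Vec; []; _∷_)
open import Data.List as List using (List; []; _∷_; _++_; allFin)
open import Data.List.Relation.Unary.All as All using (All; []; _∷_)
import Data.List.Relation.Unary.All.Properties as Allₚ
open import Data.List.Relation.Unary.Any using (Any; here; there)
import Data.List.Relation.Unary.Any.Properties as Anyₚ
open import Data.List.Membership.Propositional using (_∈_)
open import Data.List.Membership.Propositional.Properties using (∈-concatMap⁺)
open import Data.Product using (Σ; ∃-syntax; _×_; _,_; proj₁; proj₂)
open import Data.Product.Function.NonDependent.Propositional using (_×-⇔_)
open import Data.Sum using (_⊎_; inj₁; inj₂; [_,_])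
open import Data.Sum.Function.Propositional using (_⊎-⇔_)
open import Data.Empty using (⊥-elim)
open import Function using (_∘_; id)
open import Function.Bundles using (_⇔_; mk⇔; Equivalence)
open import Relation.Binary.Definitions using (tri<; tri≈; tri>)
open import Relation.Binary.PropositionalEquality using (_≡_; _≢_; refl; sym; subst)
open import Relation.Nullary using (¬_)

open Equivalence using (to; from)
open import Function.Properties.Equivalence using () renaming (trans to ⇔-trans; sym to ⇔-sym)

×→⇔ : ∀ {A B : Set} → (A → B) × (B → A) → A ⇔ B
×→⇔ (f , g) = mk⇔ f g

⇔→× : ∀ {A B : Set} → A ⇔ B → (A → B) × (B → A)
⇔→× e = to e , from e

by-contradiction : (∀ (A : Set) → A ⊎ ¬ A) → ∀ {A} → ¬ ¬ A → A
by-contradiction lem {A} ¬¬a = [ id , ⊥-elim ∘ ¬¬a ] (lem A)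

All-allFin : ∀ {A : Set} {P : A → Set} {m} (g : Fin m → A) →
             All P (List.map g (allFin m)) ⇔ (∀ i → P (g i))
All-allFin g = mk⇔ (Allₚ.tabulate⁻ ∘ Allₚ.map⁻) (Allₚ.map⁺ ∘ Allₚ.tabulate⁺)

++⁻₄ : ∀ {A : Set} {P : A → Set} xs ys zs {ws} → All P (xs ++ ys ++ zs ++ ws) →
       All P xs × All P ys × All P zs × All P ws
++⁻₄ xs ys zs h =
  let (pxs , h′) = Allₚ.++⁻ xs h ; (pys , h″) = Allₚ.++⁻ ys h′ ; (pzs , pws) = Allₚ.++⁻ zs h″
  in pxs , pys , pzs , pws

choice⋆ : ∀ {A A⋆ : Set} → (A → A⋆) → (A⋆ → A) → A ⊎ ¬ A → A⋆ ⊎ (¬ A⋆ × ¬ A)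
choice⋆ a→a⋆ a⋆→a = [ inj₁ ∘ a→a⋆ , (λ ¬a → inj₂ (¬a ∘ a⋆→a , ¬a)) ]

∈-if : ∀ {A : Set} {b} {x : A} → T b → x ∈ (if b then x ∷ [] else [])
∈-if {b = true} _ = here refl

∈-distinctPairs : ∀ {k} {i j : Fin (suc k)} → i < j → (i , j) ∈ distinctPairs
∈-distinctPairs {k} {i} {j} i<j =
  ∈-concatMap⁺ (λ i → List.concatMap (pair i) (allFin (suc k)))
    (Anyₚ.tabulate⁺ {f = id} i (∈-concatMap⁺ (pair i) (Anyₚ.tabulate⁺ {f = id} j (∈-if (<⇒<ᵇ i<j)))))
  where
  pair : Fin (suc k) → Fin (suc k) → List (Fin (suc k) × Fin (suc k))
  pair i j = if toℕ i <ᵇ toℕ j then (i , j) ∷ [] else []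

module _ {k n : ℕ} where

  record Conjunctive (V : Formula k n → Set) : Set where
    field
      ∧-elim  : ∀ {F G} → V (F ∧' G) → V F × V G
      ∧-intro : ∀ {F G} → V F × V G → V (F ∧' G)
      ⊤-intro : V ⊤'

  ⋀⇔All : ∀ {V} → Conjunctive V → ∀ Fs → V (⋀ Fs) ⇔ All V Fs
  ⋀⇔All C []       = mk⇔ (λ _ → []) (λ _ → Conjunctive.⊤-intro C)
  ⋀⇔All C (F ∷ Fs) = mk⇔
    (λ h → let (v , vs) = Conjunctive.∧-elim C h in v ∷ to (⋀⇔All C Fs) vs)
    (λ { (v ∷ vs) → Conjunctive.∧-intro C (v , from (⋀⇔All C Fs) vs) })

stepFacts : ∀ {k} → List (Formula k 0)
stepFacts {k} = List.map (λ i → Step (ĉ i)) (allFin (suc k))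

nextFacts : ∀ {k} → List (Formula k 0)
nextFacts {k} = List.map (λ i → Next (ĉ (inject₁ i)) (ĉ (suc i))) (allFin k)

module _ {k : ℕ} (I : Interp k) where
  open Interp I

  eval-conjunctive : ∀ {n} (R : Rel I) (ρ : Fin n → D) → Conjunctive (λ F → eval I R F ρ)
  eval-conjunctive R ρ = record { ∧-elim = id ; ∧-intro = id ; ⊤-intro = id }

  evalStar-conjunctive : ∀ {n} (u : IRel I) (ρ : Fin n → D) → Conjunctive (λ F → evalStar I u F ρ)
  evalStar-conjunctive u ρ = record { ∧-elim = id ; ∧-intro = id ; ⊤-intro = id , id }

  ⋁⇔Any : ∀ {n} {R : Rel I} {ρ : Fin n → D} Fs → eval I R (⋁ Fs) ρ ⇔ Any (λ F → eval I R F ρ) Fs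
  ⋁⇔Any []       = mk⇔ (λ ()) (λ ())
  ⋁⇔Any (F ∷ Fs) = mk⇔ [ here , there ∘ to (⋁⇔Any Fs) ]
                       (λ { (here v) → inj₁ v ; (there v) → inj₂ (from (⋁⇔Any Fs) v) })

  ⋁-allFin : ∀ {n m} {R : Rel I} {ρ : Fin n → D} (g : Fin m → Formula k n) →
             eval I R (⋁ (List.map g (allFin m))) ρ ⇔ (∃[ i ] eval I R (g i) ρ)
  ⋁-allFin g = mk⇔ (Anyₚ.tabulate⁻ ∘ Anyₚ.map⁻ ∘ to (⋁⇔Any _))
                   (λ (i , v) → from (⋁⇔Any _) (Anyₚ.map⁺ (Anyₚ.tabulate⁺ i v)))

  evalStar-pI : ∀ {n} (F : Formula k n) (ρ : Fin n → D) → evalStar I (pI I) F ρ ⇔ eval I rel F ρ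
  evalStar-pI ⊥'                 ρ = mk⇔ id id
  evalStar-pI (atom (intl P) ts) ρ = mk⇔ id id
  evalStar-pI (atom object ts)   ρ = mk⇔ id id
  evalStar-pI (atom place ts)    ρ = mk⇔ id id
  evalStar-pI (atom move ts)     ρ = mk⇔ id id
  evalStar-pI (t ≐ s)            ρ = mk⇔ id id
  evalStar-pI (F ∧' G)           ρ = evalStar-pI F ρ ×-⇔ evalStar-pI G ρ
  evalStar-pI (F ∨' G)           ρ = evalStar-pI F ρ ⊎-⇔ evalStar-pI G ρ
  evalStar-pI (F ⇒' G)           ρ =
    mk⇔ proj₂ (λ h → (λ f → from (evalStar-pI G ρ) (h (to (evalStar-pI F ρ) f))) , h)
  evalStar-pI (∀' F)             ρ =
    mk⇔ (λ h d → to (evalStar-pI F _) (h d)) (λ h d → from (evalStar-pI F _) (h d))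
  evalStar-pI (∃' F)             ρ =
    mk⇔ (λ (d , h) → d , to (evalStar-pI F _) h) (λ (d , h) → d , from (evalStar-pI F _) h)

  STEP OBJECT PLACE : D → Set
  STEP d   = rel (intl step) (d ∷ [])
  OBJECT d = rel object (d ∷ [])
  PLACE d  = rel place (d ∷ [])

  NEXT : D → D → Set
  NEXT z t = rel (intl next) (z ∷ t ∷ [])

  AT MOVE : D → D → D → Set
  AT x y z   = rel (intl at) (x ∷ y ∷ z ∷ [])
  MOVE x y z = rel move (x ∷ y ∷ z ∷ [])

  Constant : D → Set
  Constant z = ∃[ i ] z ≡ const i

  Consecutive : D → D → Set
  Consecutive z t = ∃[ i ] (z ≡ const (inject₁ i) × t ≡ const (suc i))

  MovesOrStays : D → D → Fin k → Set
  MovesOrStays x y i =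
    MOVE x y (const (inject₁ i)) ⊎ (AT x y (const (inject₁ i)) × ¬ (∃[ w ] MOVE x w (const (inject₁ i))))

  StepDomain NextDomain Inertia : Set
  StepDomain = ∀ z → STEP z ⇔ Constant z
  NextDomain = ∀ z t → NEXT z t ⇔ Consecutive z t
  Inertia    = ∀ i x y → AT x y (const (suc i)) ⇔ MovesOrStays x y i

  record HAxioms : Set where
    field
      distinct      : ∀ {i j} → (i , j) ∈ distinctPairs → const i ≢ const j
      at-sorted     : ∀ {x y z} → AT x y z → OBJECT x × PLACE y × STEP z
      move-sorted   : ∀ {x y z} → MOVE x y z → OBJECT x × PLACE y × STEP z
      at-functional : ∀ {x y₁ y₂ z} → AT x y₁ z → AT x y₂ z → y₁ ≡ y₂
      at-total      : ∀ {x z} → OBJECT x → STEP z → ∃[ y ] AT x y z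

  -- Models of the reduct of M relative to pI I: a choice rule yields its head only where I
  -- already makes it true.  When I ⊨ M, a u ≤ pI I satisfies M⋆(u) exactly if it is such a model.
  record ReductModel (u : IRel I) : Set where
    field
      step-facts     : ∀ i → u step (const i ∷ [])
      next-facts     : ∀ i → u next (const (inject₁ i) ∷ const (suc i) ∷ [])
      move-rule      : ∀ {x y z t} → MOVE x y z → u next (z ∷ t ∷ []) → u at (x ∷ y ∷ t ∷ [])
      initial-choice : ∀ {x y} → OBJECT x → PLACE y → AT x y (const zero) →
                       u at (x ∷ y ∷ const zero ∷ [])
      inertia-choice : ∀ {x y z t} → u at (x ∷ y ∷ z ∷ []) → u next (z ∷ t ∷ []) → AT x y t →
                       u at (x ∷ y ∷ t ∷ [])

  M⋆→reduct : ∀ {u : IRel I} {ρ : Fin 0 → D} → evalStar I u (M k) ρ → ReductModel u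
  M⋆→reduct {u} {ρ} h
    with ++⁻₄ stepFacts nextFacts distinctConsts (to (⋀⇔All (evalStar-conjunctive u ρ) _) h)
  ... | sf , nf , _ , _ ∷ _ ∷ _ ∷ _ ∷ r₆ ∷ c₇ ∷ c₈ ∷ [] = record
    { step-facts     = to (All-allFin _) sf
    ; next-facts     = to (All-allFin _) nf
    ; move-rule      = λ mv nx → proj₁ (r₆ _ _ _ _) (mv , nx)
    ; initial-choice = λ o pl a → [ id , (λ (_ , ¬a) → ⊥-elim (¬a a)) ] (proj₁ (c₇ _ _) (o , pl))
    ; inertia-choice = λ ua nx a → [ id , (λ (_ , ¬a) → ⊥-elim (¬a a)) ] (proj₁ (c₈ _ _ _ _) (ua , nx))
    }

  M→HAxioms : (∀ (A : Set) → A ⊎ ¬ A) → ∀ {ρ : Fin 0 → D} → eval I rel (M k) ρ → HAxioms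
  M→HAxioms lem {ρ} h
    with ++⁻₄ stepFacts nextFacts distinctConsts (to (⋀⇔All (eval-conjunctive rel ρ) _) h)
  ... | _ , _ , dc , c₃ ∷ c₃′ ∷ c₄ ∷ c₅ ∷ _ = record
    { distinct      = All.lookup (Allₚ.map⁻ dc)
    ; at-sorted     = λ a → by-contradiction lem λ ¬s → c₃ _ _ _ (a , ¬s)
    ; move-sorted   = λ mv → by-contradiction lem λ ¬s → c₃′ _ _ _ (mv , ¬s)
    ; at-functional = λ a₁ a₂ → by-contradiction lem λ ≢ → c₄ _ _ _ _ (a₁ , a₂ , ≢)
    ; at-total      = λ o s → by-contradiction lem λ ∄ → c₅ _ _ (o , s , ∄)
    }

  module _ (at? : ∀ x y t → AT x y t ⊎ ¬ AT x y t) (ax : HAxioms) (R₀ : ReductModel (pI I)) where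
    open HAxioms ax
    open ReductModel

    reduct→M⋆ : ∀ {u : IRel I} → _≤ᵤ_ I u (pI I) → ReductModel u → ∀ {ρ} → evalStar I u (M k) ρ
    -- A constraint ¬G contributes ¬G⋆ × ¬G; G⋆ implies G because u ≤ pI I.
    reduct→M⋆ {u} u≤p R {ρ} = from (⋀⇔All (evalStar-conjunctive u ρ) _)
      (Allₚ.++⁺ (from (All-allFin _) (step-facts R))
      (Allₚ.++⁺ (from (All-allFin _) (next-facts R))
      (Allₚ.++⁺ (Allₚ.map⁺ (All.tabulate λ m → distinct m , distinct m))
        ( (λ _ _ _ → (λ (ua , _ , ¬s) → ¬s (at-sorted (u≤p at _ ua))) , (λ (a , ¬s) → ¬s (at-sorted a)))
        ∷ (λ _ _ _ → (λ (mv , _ , ¬s) → ¬s (move-sorted mv)) , (λ (mv , ¬s) → ¬s (move-sorted mv)))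
        ∷ (λ _ _ _ _ → (λ (ua₁ , ua₂ , _ , ≢) → ≢ (at-functional (u≤p at _ ua₁) (u≤p at _ ua₂)))
                     , (λ (a₁ , a₂ , ≢) → ≢ (at-functional a₁ a₂)))
        ∷ (λ _ _ → (λ (o , s , _ , ∄) → ∄ (at-total o (u≤p step _ s))) , (λ (o , s , ∄) → ∄ (at-total o s)))
        ∷ (λ _ _ _ _ → (λ (mv , nx) → move-rule R mv nx) , (λ (mv , nx) → move-rule R₀ mv nx))
        ∷ (λ _ _ → (λ (o , pl) → choice⋆ (initial-choice R o pl) (u≤p at _) (at? _ _ _)) , (λ _ → at? _ _ _))
        ∷ (λ _ _ _ _ → (λ (ua , nx) → choice⋆ (inertia-choice R ua nx) (u≤p at _) (at? _ _ _))
                     , (λ _ → at? _ _ _))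
        ∷ []))))

    reduct→M : ∀ {ρ} → eval I rel (M k) ρ
    reduct→M = to (evalStar-pI (M k) _) (reduct→M⋆ (λ _ _ → id) R₀)

  M→reduct : ∀ {ρ : Fin 0 → D} → eval I rel (M k) ρ → ReductModel (pI I)
  M→reduct {ρ} = M⋆→reduct ∘ from (evalStar-pI (M k) ρ)

  H⇔HAxioms : ∀ {ρ : Fin 0 → D} → eval I rel (H k) ρ ⇔ HAxioms
  H⇔HAxioms {ρ} = mk⇔ axioms satisfies
    where
    axioms : eval I rel (H k) ρ → HAxioms
    axioms h with Allₚ.++⁻ distinctConsts (to (⋀⇔All (eval-conjunctive rel ρ) _) h)
    ... | dc , h₃ ∷ h₃′ ∷ h₄ ∷ h₅ ∷ [] = record
      { distinct      = All.lookup (Allₚ.map⁻ dc)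
      ; at-sorted     = h₃ _ _ _
      ; move-sorted   = h₃′ _ _ _
      ; at-functional = λ a₁ a₂ → h₄ _ _ _ _ (a₁ , a₂)
      ; at-total      = λ o s → h₅ _ _ (o , s)
      }

    satisfies : HAxioms → eval I rel (H k) ρ
    satisfies ax = from (⋀⇔All (eval-conjunctive rel ρ) _) (Allₚ.++⁺ (Allₚ.map⁺ (All.tabulate distinct))
      ( (λ _ _ _ → at-sorted)
      ∷ (λ _ _ _ → move-sorted)
      ∷ (λ _ _ _ _ (a₁ , a₂) → at-functional a₁ a₂)
      ∷ (λ _ _ (o , s) → at-total o s)
      ∷ []))
      where open HAxioms ax

  ⋁-constants : ∀ {n} (σ : Fin (suc n) → D) →
    eval I rel (⋁ (List.map (λ i → x0 ≐ ĉ i) (allFin (suc k)))) σ ⇔ Constant (σ zero)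
  ⋁-constants σ = ⋁-allFin _

  ⋁-consecutive : ∀ {n} (σ : Fin (suc (suc n)) → D) →
    eval I rel (⋁ (List.map (λ i → x0 ≐ ĉ (inject₁ i) ∧' x1 ≐ ĉ (suc i)) (allFin k))) σ
      ⇔ Consecutive (σ zero) (σ (suc zero))
  ⋁-consecutive σ = ⋁-allFin _

  RHS⇔ : ∀ {ρ : Fin 0 → D} → eval I rel (RHS k) ρ ⇔ (HAxioms × StepDomain × NextDomain × Inertia)
  RHS⇔ {ρ} = mk⇔
    (λ (h , steps , nexts , ats) →
         to H⇔HAxioms h
       , (λ z → ⇔-trans (×→⇔ (steps z)) (⋁-constants (extend I ρ z)))
       , (λ z t → ⇔-trans (×→⇔ (nexts t z)) (⋁-consecutive (extend I (extend I ρ t) z)))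
       , (λ i x y → ×→⇔ (to (All-allFin _) (to (⋀⇔All (eval-conjunctive rel ρ) _) ats) i y x)))
    (λ (ax , step-domain , next-domain , inertia) →
         from H⇔HAxioms ax
       , (λ z → ⇔→× (⇔-trans (step-domain z) (⇔-sym (⋁-constants (extend I ρ z)))))
       , (λ t z → ⇔→× (⇔-trans (next-domain z t) (⇔-sym (⋁-consecutive (extend I (extend I ρ t) z)))))
       , from (⋀⇔All (eval-conjunctive rel ρ) _) (from (All-allFin _) λ i y x → ⇔→× (inertia i x y)))

  GroundAtom : Set
  GroundAtom = Σ ℕ λ a → IPred a × Vec D a

  _∖_ : IRel I → GroundAtom → IRel I
  (u ∖ α) P xs = u P xs × (_ , P , xs) ≢ α

  ∖-< : ∀ {u : IRel I} {a} {P : IPred a} {xs} → u P xs → _<ᵤ_ I (u ∖ (a , P , xs)) u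
  ∖-< uPxs = (λ _ _ → proj₁) , (λ u≤u∖α → proj₂ (u≤u∖α _ _ uPxs) refl)

  module _ (R₀ : ReductModel (pI I)) where
    open ReductModel R₀

    ∖step-reduct : ∀ {z} → ¬ Constant z → ReductModel (pI I ∖ (1 , step , z ∷ []))
    ∖step-reduct ¬c = record
      { step-facts     = λ i → step-facts i , λ { refl → ¬c (i , refl) }
      ; next-facts     = λ i → next-facts i , λ ()
      ; move-rule      = λ mv (nx , _) → move-rule mv nx , λ ()
      ; initial-choice = λ _ _ a → a , λ ()
      ; inertia-choice = λ _ _ a → a , λ ()
      }

    ∖next-reduct : ∀ {z t} → ¬ Consecutive z t → ReductModel (pI I ∖ (2 , next , z ∷ t ∷ []))
    ∖next-reduct ¬c = record
      { step-facts     = λ i → step-facts i , λ ()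
      ; next-facts     = λ i → next-facts i , λ { refl → ¬c (i , refl , refl) }
      ; move-rule      = λ mv (nx , _) → move-rule mv nx , λ ()
      ; initial-choice = λ _ _ a → a , λ ()
      ; inertia-choice = λ _ _ a → a , λ ()
      }

    ∖at-reduct : ∀ {x y t} → const zero ≢ t →
                 (∀ {z} → MOVE x y z → ¬ NEXT z t) → (∀ {z} → AT x y z → ¬ NEXT z t) →
                 ReductModel (pI I ∖ (3 , at , x ∷ y ∷ t ∷ []))
    ∖at-reduct not-initial not-moved not-stayed = record
      { step-facts     = λ i → step-facts i , λ ()
      ; next-facts     = λ i → next-facts i , λ ()
      ; move-rule      = λ mv (nx , _) → move-rule mv nx , λ { refl → not-moved mv nx }
      ; initial-choice = λ _ _ a → a , λ { refl → not-initial refl }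
      ; inertia-choice = λ (a , _) (nx , _) a′ → a′ , λ { refl → not-stayed a nx }
      }

  const-injective : HAxioms → ∀ {i j} → const i ≡ const j → i ≡ j
  const-injective ax {i} {j} e with <-cmp i j
  ... | tri< i<j _ _ = ⊥-elim (HAxioms.distinct ax (∈-distinctPairs i<j) e)
  ... | tri≈ _ i≡j _ = i≡j
  ... | tri> _ _ j<i = ⊥-elim (HAxioms.distinct ax (∈-distinctPairs j<i) (sym e))

  module StableModel (lem : ∀ (A : Set) → A ⊎ ¬ A) (sm : SM I (M k)) where
    ax : HAxioms
    ax = M→HAxioms lem (proj₁ sm)

    R₀ : ReductModel (pI I)
    R₀ = M→reduct (proj₁ sm)

    open HAxioms ax
    open ReductModel R₀

    unremovable : ∀ {a} {Q : IPred a} {xs} → pI I Q xs → ¬ ReductModel (pI I ∖ (a , Q , xs))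
    unremovable pα R = proj₂ sm (_ , ∖-< pα , reduct→M⋆ (λ _ _ _ → lem _) ax R₀ (proj₁ (∖-< pα)) R)

    step-domain : StepDomain
    step-domain _ = mk⇔ (λ s → by-contradiction lem λ ¬c → unremovable s (∖step-reduct R₀ ¬c))
                        (λ { (i , refl) → step-facts i })

    next-domain : NextDomain
    next-domain _ _ = mk⇔ (λ nx → by-contradiction lem λ ¬c → unremovable nx (∖next-reduct R₀ ¬c))
                          (λ { (i , refl , refl) → next-facts i })

    predecessor : ∀ {z i} → NEXT z (const (suc i)) → z ≡ const (inject₁ i)
    predecessor nx with to (next-domain _ _) nx
    ... | j , refl , e with suc-injective (const-injective ax e)
    ... | refl = refl

    initial≢successor : ∀ {i} → const zero ≢ const (suc i)
    initial≢successor e with const-injective ax e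
    ... | ()

    inertia : Inertia
    inertia i x y = mk⇔ forward backward
      where
      cᵢ cᵢ₊₁ : D
      cᵢ   = const (inject₁ i)
      cᵢ₊₁ = const (suc i)

      forward : AT x y cᵢ₊₁ → MovesOrStays x y i
      forward a = by-contradiction lem λ ¬r → unremovable a (∖at-reduct R₀ initial≢successor
          (λ mv nx → ¬r (inj₁ (subst (MOVE x y) (predecessor nx) mv)))
          (λ a′ nx → ¬r (inj₂ (subst (AT x y) (predecessor nx) a′ , λ (_ , mv) → ¬r (inj₁ (moved-to-y mv))))))
        where
        moved-to-y : ∀ {w} → MOVE x w cᵢ → MOVE x y cᵢ
        moved-to-y mv = subst (λ w → MOVE x w cᵢ) (at-functional (move-rule mv (next-facts i)) a) mv

      backward : MovesOrStays x y i → AT x y cᵢ₊₁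
      backward (inj₁ mv) = move-rule mv (next-facts i)
      backward (inj₂ (a , ∄move)) = by-contradiction lem λ ¬a →
        let (y′ , a′) = at-total (proj₁ (at-sorted a)) (step-facts (suc i)) in
        unremovable a′ (∖at-reduct R₀ initial≢successor
          (λ mv nx → ∄move (y′ , subst (MOVE x y′) (predecessor nx) mv))
          (λ a″ nx → ¬a (subst (λ w → AT x w cᵢ₊₁)
                               (sym (at-functional a (subst (AT x y′) (predecessor nx) a″))) a′)))

  module _ (ax : HAxioms) (step-domain : StepDomain) (next-domain : NextDomain) (inertia : Inertia) where
    open HAxioms ax
    open ReductModel

    domains→reduct : ReductModel (pI I)
    domains→reduct = record
      { step-facts     = λ i → from (step-domain _) (i , refl)
      ; next-facts     = λ i → from (next-domain _ _) (i , refl , refl)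
      ; move-rule      = moves
      ; initial-choice = λ _ _ → id
      ; inertia-choice = λ _ _ → id
      }
      where
      moves : ∀ {x y z t} → MOVE x y z → NEXT z t → AT x y t
      moves mv nx with to (next-domain _ _) nx
      ... | i , refl , refl = from (inertia i _ _) (inj₁ mv)

    reduct-contains : ∀ {u : IRel I} → ReductModel u → _≤ᵤ_ I (pI I) u
    reduct-contains R step (z ∷ []) s with to (step-domain z) s
    ... | i , refl = step-facts R i
    reduct-contains R next (z ∷ t ∷ []) nx with to (next-domain z t) nx
    ... | i , refl , refl = next-facts R i
    reduct-contains {u} R at (x ∷ y ∷ z ∷ []) a with to (step-domain z) (proj₂ (proj₂ (at-sorted a)))
    ... | c , refl = <-weakInduction Reached initial successor c a
      where
      Reached : Fin (suc k) → Set
      Reached c = ∀ {x y} → AT x y (const c) → u at (x ∷ y ∷ const c ∷ [])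

      initial : Reached zero
      initial a = let (o , pl , _) = at-sorted a in initial-choice R o pl a

      successor : ∀ i → Reached (inject₁ i) → Reached (suc i)
      successor i reached a with to (inertia i _ _) a
      ... | inj₁ mv       = move-rule R mv (next-facts R i)
      ... | inj₂ (a′ , _) = inertia-choice R (reached a′) (next-facts R i) a

proposition3 : (k : ℕ) (I : Interp k) → (∀ (A : Set) → A ⊎ ¬ A) →
    SM I (M k) ⇔ ⟦_⟧ I (RHS k)
proposition3 k I lem = mk⇔ stable⇒rhs rhs⇒stable
  where
  stable⇒rhs : SM I (M k) → ⟦_⟧ I (RHS k)
  stable⇒rhs sm = from (RHS⇔ I) (ax , step-domain , next-domain , inertia)
    where open StableModel I lem sm

  rhs⇒stable : ⟦_⟧ I (RHS k) → SM I (M k)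
  rhs⇒stable rhs with to (RHS⇔ I) rhs
  ... | ax , sd , nd , inr =
      reduct→M I (λ _ _ _ → lem _) ax (domains→reduct I ax sd nd inr)
    , λ (u , (_ , p≰u) , u⊨M⋆) → p≰u (reduct-contains I ax sd nd inr (M⋆→reduct I u⊨M⋆))
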